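{- Let $p\ge 0$ be an integer, $G$ a graph with path-width $p$, and $G'$ a $[p+1]$-interval graph obtained from $G$ by equipping it with a semi-interval representation and a vertex coloring. Let $I(t_{[p+1]}(G'))$ denote the graph whose vertices are the nodes of $t_{[p+1]}(G')$ whose color has third coordinate not containing $\leftarrow$, two such nodes being adjacent if and only if they are associated with adjacent vertices of $G'$. Then $I(t_{[p+1]}(G'))$ is isomorphic to $G$. Moreover, the number of nodes of $t_{[p+1]}(G')$ is at most $(p+1)|G|+1$.
   Context: $[p+1]=\{1,\dots,p+1\}$. A semi-interval representation of a graph assigns to each vertex $v$ an interval $J_v=[k,\ell)$ with integers $k<\ell$ such that adjacent vertices have intersecting intervals; segments are intervals $[k,k+1)$; the first segment is the leftmost one intersected by some $J_v$. An $A$-interval graph is a graph with a semi-interval representation whose intervals are colored by elements of $A$ so that intersecting intervals get different colors. The plane tree $t_A(G)$, each non-root node having a color in $A\times 2^A\times 2^{\{\rightarrow,\leftarrow\}}$ and associated with a vertex of $G$, is defined recursively. If $G$ is empty, $t_A(G)$ is a single root node. Otherwise let $v$ be a vertex with a longest interval among those intersecting the first segment, $x$ its color, $A'=A\setminus\{x\}$. Let $G'$ be the $A'$-interval graph obtained by restricting $G\setminus\{v\}$ to vertices whose intervals intersect $J_v$, with intervals restricted to the segments contained in $J_v$. Let $G''$ be the $A$-interval graph obtained by restricting $G$ to vertices whose intervals intersect the complement of $J_v$, with intervals restricted to segments not contained in $J_v$, and removing all edges between vertices of $G''$ that are also edges of $G'$. Then $t_A(G)$ is obtained from $t_A(G'')$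 by attaching $t_{A'}(G')$ so that its root becomes the first child of the root of $t_A(G'')$; this node is colored $(x,\emptyset,\emptyset)$ and associated with $v$; other nodes keep colors and associations from $t_{A'}(G')$ and $t_A(G'')$, except: $x$ is inserted into the second coordinate of each node of $t_{A'}(G')$ associated with a vertex adjacent to $v$ whose third coordinate does not contain $\leftarrow$; $\rightarrow$ is inserted into the third coordinate of each node of $t_{A'}(G')$ associated with a vertex in $V(G')\cap V(G'')$; $\leftarrow$ is inserted into the third coordinate of each node of $t_A(G'')$ associated with a vertex in $V(G')\cap V(G'')$. -}

module Defs where

open import Data.Nat using (ℕ; suc; _+_)
open import Data.Integer as ℤ using (ℤ; _⊔_; _⊓_; _-_)
open import Data.Integer.Properties using () renaming (_<?_ to _<ℤ?_)
open import Data.Fin as Fin using (Fin)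
open import Data.Fin.Subset using (Subset; _∈_; ⁅_⁆; _∪_; ∣_∣) renaming (⊥ to ∅)
open import Data.Bool using (Bool; true; false; _∧_; _∨_; not; if_then_else_)
open import Data.List using (List; []; _∷_; _++_; length; lookup; filterᵇ)
open import Data.Product using (Σ; _×_; _,_; proj₁; proj₂; ∃)
open import Relation.Nullary using (¬_; does)
open import Relation.Binary using (Rel; Decidable)
open import Relation.Binary.PropositionalEquality using (_≡_)
open import Function.Bundles using (_⇔_)
open import Function.Definitions using (Bijective)

record SimpleGraph (n : ℕ) : Set₁ where
  field
    Adj   : Rel (Fin n) _
    adj?  : Decidable Adj
    sym   : ∀ {u w} → Adj u w → Adj w u
    irrefl : ∀ {u} → ¬ Adj u u
open SimpleGraph public

Isomorphic : ∀ {m n} → SimpleGraph m → SimpleGraph n → Set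
Isomorphic {m} {n} H G =
  Σ (Fin m → Fin n) λ φ → Bijective _≡_ _≡_ φ ×
    (∀ i j → Adj H i j ⇔ Adj G (φ i) (φ j))

record IsPathDecomposition {n : ℕ} (G : SimpleGraph n) (m : ℕ)
                           (B : Fin m → Subset n) : Set where
  field
    covers-vertices : ∀ v → ∃ λ i → v ∈ B i
    covers-edges    : ∀ u v → Adj G u v → ∃ λ i → (u ∈ B i × v ∈ B i)
    consecutive     : ∀ v (i j k : Fin m) → i Fin.≤ j → j Fin.≤ k →
                      v ∈ B i → v ∈ B k → v ∈ B j

WidthAtMost : ∀ {n m} → (Fin m → Subset n) → ℕ → Set
WidthAtMost B q = ∀ i → ∣ B i ∣ Data.Nat.≤ suc q

HasPathWidth : ∀ {n} → SimpleGraph n → ℕ → Set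
HasPathWidth {n} G p =
  (Σ ℕ λ m → Σ (Fin m → Subset n) λ B →
      IsPathDecomposition G m B × WidthAtMost B p)
  × (∀ m (B : Fin m → Subset n) q →
      IsPathDecomposition G m B → WidthAtMost B q → p Data.Nat.≤ q)

-- Semi-interval representations and A-interval graphs
-- An interval [k , ℓ) is the pair (k , ℓ) of integers.

Interval : Set
Interval = ℤ × ℤ

start end : Interval → ℤ
start = proj₁
end   = proj₂

-- the segment [s , s+1) is contained in (intersects) the interval J
_∋seg_ : Interval → ℤ → Set
J ∋seg s = start J ℤ.≤ s × s ℤ.< end J

Intersect : Interval → Interval → Set
Intersect J K = start J ℤ.< end K × start K ℤ.< end J

intersectᵇ : Interval → Interval → Bool
intersectᵇ J K = does (start J <ℤ? end K) ∧ does (start K <ℤ? end J)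

len : Interval → ℤ
len J = end J - start J

-- A (p+1)-interval graph structure on G (colors in [p+1] = Fin (p+1)):
-- a semi-interval representation together with a proper coloring.
record IntervalColoring {n : ℕ} (G : SimpleGraph n) (c : ℕ) : Set where
  field
    J        : Fin n → Interval
    nonempty : ∀ v → start (J v) ℤ.< end (J v)
    rep      : ∀ u v → Adj G u v → Intersect (J u) (J v)
    col      : Fin n → Fin c
    proper   : ∀ u v → ¬ u ≡ v → Intersect (J u) (J v) → ¬ col u ≡ col v
open IntervalColoring public

-- Node colors in A × 2^A × 2^{→,←}; the third coordinate is
-- encoded by two booleans (→ ∈ ?, ← ∈ ?).
record Label (c : ℕ) : Set where
  constructor lbl
  field
    first  : Fin c
    second : Subset c
    right  : Bool
    left   : Bool
open Label public

-- A non-root node: associated vertex, color, ordered list of children.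
data Node (n c : ℕ) : Set where
  nd : Fin n → Label c → List (Node n c) → Node n c

-- A rooted plane tree is given by the ordered list of the root's children.
Tree : ℕ → ℕ → Set
Tree n c = List (Node n c)

mutual
  mapNode : ∀ {n c} → (Fin n → Label c → Label c) → Node n c → Node n c
  mapNode f (nd v l ts) = nd v (f v l) (mapNodes f ts)

  mapNodes : ∀ {n c} → (Fin n → Label c → Label c) → Tree n c → Tree n c
  mapNodes f []       = []
  mapNodes f (t ∷ ts) = mapNode f t ∷ mapNodes f ts

mutual
  nodesN : ∀ {n c} → Node n c → List (Fin n × Label c)
  nodesN (nd v l ts) = (v , l) ∷ nodes ts

  nodes : ∀ {n c} → Tree n c → List (Fin n × Label c)
  nodes []       = []
  nodes (t ∷ ts) = nodesN t ++ nodes ts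

size : ∀ {n c} → Tree n c → ℕ
size t = suc (length (nodes t))

-- Intermediate interval graphs arising in the recursion: all are
-- induced on subsets of the original vertex set Fin n, with the
-- original coloring; only vertex set, intervals and edges change.
record State (n : ℕ) : Set where
  field
    V : Fin n → Bool
    I : Fin n → Interval
    E : Fin n → Fin n → Bool
open State public

IsFirstSegment : ∀ {n} → State n → ℤ → Set
IsFirstSegment st s =
  (∃ λ w → V st w ≡ true × I st w ∋seg s) ×
  (∀ w s' → V st w ≡ true → I st w ∋seg s' → s ℤ.≤ s')

module _ {n : ℕ} (st : State n) (v : Fin n) where
  private
    k ℓ : ℤ
    k = start (I st v)
    ℓ = end (I st v)

  V′ : Fin n → Bool
  V′ w = V st w ∧ not (does (w Fin.≟ v)) ∧ intersectᵇ (I st w) (I st v)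

  V″ : Fin n → Bool
  V″ w = V st w ∧ (does (start (I st w) <ℤ? k) ∨ does (ℓ <ℤ? end (I st w)))

  E′ : Fin n → Fin n → Bool
  E′ u w = E st u w ∧ V′ u ∧ V′ w

  sub′ : State n
  sub′ = record
    { V = V′
    ; I = λ w → (start (I st w) ⊔ k , end (I st w) ⊓ ℓ)
    ; E = E′ }

  sub″ : State n
  sub″ = record
    { V = V″
    ; I = λ w → if does (ℓ <ℤ? end (I st w))
                  then (start (I st w) ⊔ ℓ , end (I st w))
                  else (start (I st w) , end (I st w) ⊓ k)
    ; E = λ u w → E st u w ∧ V″ u ∧ V″ w ∧ not (E′ u w) }

  both : Fin n → Bool
  both w = V′ w ∧ V″ w

  mod′ : ∀ {c} → Fin c → Fin n → Label c → Label c
  mod′ x w (lbl y S r l) =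
    lbl y (if E st v w ∧ not l then S ∪ ⁅ x ⁆ else S) (r ∨ both w) l

  mod″ : ∀ {c} → Fin n → Label c → Label c
  mod″ w (lbl y S r l) = lbl y S r (l ∨ both w)

-- BuildsTree col st t : t is a tree t_A(st) produced by the recursive
-- construction (any admissible choice of the vertex v at each step).
data BuildsTree {n c : ℕ} (col : Fin n → Fin c) : State n → Tree n c → Set where
  empty : ∀ {st} → (∀ w → V st w ≡ false) → BuildsTree col st []
  step  : ∀ {st} (v : Fin n) (s : ℤ) {t′ t″ : Tree n c} →
          IsFirstSegment st s →
          V st v ≡ true →
          I st v ∋seg s →
          (∀ w → V st w ≡ true → I st w ∋seg s → len (I st w) ℤ.≤ len (I st v)) →
          BuildsTree col (sub′ st v) t′ →
          BuildsTree col (sub″ st v) t″ →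
          BuildsTree col st
            (nd v (lbl (col v) ∅ false false) (mapNodes (mod′ st v (col v)) t′)
              ∷ mapNodes (mod″ st v) t″)

initState : ∀ {n c} (G : SimpleGraph n) → IntervalColoring G c → State n
initState G R = record
  { V = λ _ → true
  ; I = J R
  ; E = λ u w → does (adj? G u w) }

IsT : ∀ {n c} (G : SimpleGraph n) → IntervalColoring G c → Tree n c → Set
IsT G R t = BuildsTree (col R) (initState G R) t

Inodes : ∀ {n c} → Tree n c → List (Fin n × Label c)
Inodes t = filterᵇ (λ q → not (left (proj₂ q))) (nodes t)

Igraph : ∀ {n c} (G : SimpleGraph n) (t : Tree n c) →
         SimpleGraph (length (Inodes t))
Igraph G t = record
  { Adj    = λ i j → Adj G (vx i) (vx j)
  ; adj?   = λ i j → adj? G (vx i) (vx j)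
  ; sym    = sym G
  ; irrefl = irrefl G }
  where
  vx : Fin (length (Inodes t)) → _
  vx i = proj₁ (lookup (Inodes t) i)

-- Every vertex w of the current interval graph is associated with exactly one
-- node not marked ←: when the chosen vertex v is split off, w survives in G′,
-- in G″ or in both, and in the last case precisely its nodes in t(G″) get ←.
-- Hence the unmarked nodes are in bijection with the vertices, and I(t) ≅ G
-- because I(t) takes its edges from G.
--
-- For the size bound, w gains nodes in t(G′) only with one colour fewer
-- available (the colour of v, as J_w meets J_v), while a copy of w in G″ that
-- also lies in G′ starts at the first segment of G″ and is therefore associated
-- with a single node of t(G″).  So every vertex is associated with at most p+1
-- nodes.
module Submission where

open import Defs hiding (sym)
open import Algebra.Bundles using (AbelianGroup)
open import Data.Nat using (ℕ; zero; suc; _+_; _*_; _≤_; _<_; z≤n; s≤s)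
import Data.Nat.Properties as ℕₚ
open import Data.Integer as ℤ using (ℤ; _⊔_; _⊓_)
import Data.Integer.Properties as ℤₚ
open import Data.Fin as Fin using (Fin)
open import Data.Fin.Subset using (Subset; _∉_; ⁅_⁆; _∪_; ∣_∣) renaming (⊥ to ∅)
import Data.Fin.Subset.Properties as Subsetₚ
open import Data.Bool using (Bool; true; false; _∧_; _∨_; not; if_then_else_)
open import Data.Bool.Properties using (∧-zeroʳ; ∨-zeroʳ; not-¬)
open import Data.List using (List; []; _∷_; _++_; length; lookup; filterᵇ; map)
open import Data.List.Properties using (map-++)
open import Data.Product using (_×_; _,_; proj₁; proj₂; ∃)
open import Data.Sum using (_⊎_; inj₁; inj₂)
open import Data.Empty using (⊥-elim)
open import Function using (_∘_; id)
open import Function.Bundles using (mk⇔)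
open import Function.Definitions using (Bijective)
open import Relation.Nullary using (Dec; yes; no; does)
open import Relation.Nullary.Decidable using (dec-true; dec-false)
open import Relation.Binary.PropositionalEquality
  using (_≡_; _≢_; _≗_; refl; sym; trans; cong; cong₂; subst; subst₂; module ≡-Reasoning)
open import Algebra.Properties.Group (AbelianGroup.group ℤₚ.+-0-abelianGroup) using (//-rightDividesˡ)
open import Algebra.Properties.CommutativeMonoid.Sum ℕₚ.+-0-commutativeMonoid
  using (sum-syntax; ∑-distrib-+; sum-cong-≗; sum-replicate-zero)

∧-trueˡ : ∀ {a b} → a ∧ b ≡ true → a ≡ true
∧-trueˡ {true} _ = refl

∧-trueʳ : ∀ {a b} → a ∧ b ≡ true → b ≡ true
∧-trueʳ {true} e = e

∧-falseˡ : ∀ {a b} → a ≡ false → a ∧ b ≡ false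
∧-falseˡ refl = refl

∨-true⁻ : ∀ {a b} → a ∨ b ≡ true → a ≡ true ⊎ b ≡ true
∨-true⁻ {true}  _ = inj₁ refl
∨-true⁻ {false} e = inj₂ e

does-true : ∀ {p} {P : Set p} (P? : Dec P) → does P? ≡ true → P
does-true (yes p) _ = p

indicator : Bool → ℕ
indicator true  = 1
indicator false = 0

count : ∀ {A : Set} → (A → Bool) → List A → ℕ
count p []       = 0
count p (x ∷ xs) = indicator (p x) + count p xs

module _ {A : Set} where

  count-++ : ∀ (p : A → Bool) xs ys → count p (xs ++ ys) ≡ count p xs + count p ys
  count-++ p []       ys = refl
  count-++ p (x ∷ xs) ys =
    trans (cong (indicator (p x) +_) (count-++ p xs ys)) (sym (ℕₚ.+-assoc (indicator (p x)) _ _))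

  count-map : ∀ {B : Set} (p : B → Bool) (f : A → B) xs → count p (map f xs) ≡ count (p ∘ f) xs
  count-map p f []       = refl
  count-map p f (x ∷ xs) = cong (indicator (p (f x)) +_) (count-map p f xs)

  count-filterᵇ : ∀ (q p : A → Bool) xs → count p (filterᵇ q xs) ≡ count (λ x → q x ∧ p x) xs
  count-filterᵇ q p []       = refl
  count-filterᵇ q p (x ∷ xs) with q x
  ... | true  = cong (indicator (p x) +_) (count-filterᵇ q p xs)
  ... | false = count-filterᵇ q p xs

  count-cong : ∀ {p q : A → Bool} → p ≗ q → ∀ xs → count p xs ≡ count q xs
  count-cong p≗q []       = refl
  count-cong p≗q (x ∷ xs) = cong₂ (λ b m → indicator b + m) (p≗q x) (count-cong p≗q xs)

  count-if : ∀ b (p : A → Bool) xs → count (λ x → b ∧ p x) xs ≡ (if b then count p xs else 0)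
  count-if true  p xs       = refl
  count-if false p []       = refl
  count-if false p (x ∷ xs) = count-if false p xs

module _ {A : Set} {n : ℕ} (key : A → Fin n) where

  hasKey : Fin n → A → Bool
  hasKey w a = does (key a Fin.≟ w)

  lookup-surjective : ∀ xs w → 0 < count (hasKey w) xs → ∃ λ i → key (lookup xs i) ≡ w
  lookup-surjective (x ∷ xs) w positive with key x Fin.≟ w
  ... | yes e = Fin.zero , e
  ... | no _  with i , e ← lookup-surjective xs w positive = Fin.suc i , e

  count-lookup-positive : ∀ xs i → 0 < count (hasKey (key (lookup xs i))) xs
  count-lookup-positive (x ∷ xs) Fin.zero rewrite dec-true (key x Fin.≟ key x) refl = s≤s z≤n
  count-lookup-positive (x ∷ xs) (Fin.suc i) =
    ℕₚ.≤-trans (count-lookup-positive xs i) (ℕₚ.m≤n+m _ _)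

  lookup-injective : ∀ xs → (∀ w → count (hasKey w) xs ≤ 1) →
                     ∀ i j → key (lookup xs i) ≡ key (lookup xs j) → i ≡ j
  lookup-injective (x ∷ xs) atMostOnce Fin.zero Fin.zero _ = refl
  lookup-injective (x ∷ xs) atMostOnce Fin.zero (Fin.suc j) e =
    ⊥-elim (ℕₚ.<-irrefl refl (ℕₚ.≤-trans twice (atMostOnce (key x))))
    where
    twice : 2 ≤ count (hasKey (key x)) (x ∷ xs)
    twice rewrite dec-true (key x Fin.≟ key x) refl | e = s≤s (count-lookup-positive xs j)
  lookup-injective (x ∷ xs) atMostOnce (Fin.suc i) Fin.zero e =
    sym (lookup-injective (x ∷ xs) atMostOnce Fin.zero (Fin.suc i) (sym e))
  lookup-injective (x ∷ xs) atMostOnce (Fin.suc i) (Fin.suc j) e =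
    cong Fin.suc (lookup-injective xs (λ w → ℕₚ.≤-trans (ℕₚ.m≤n+m _ _) (atMostOnce w)) i j e)

  key∘lookup-bijective : ∀ xs → (∀ w → count (hasKey w) xs ≡ 1) →
                         Bijective _≡_ _≡_ (key ∘ lookup xs)
  key∘lookup-bijective xs once =
    (λ {i} {j} → lookup-injective xs (ℕₚ.≤-reflexive ∘ once) i j) ,
    λ w → let i , e = lookup-surjective xs w (ℕₚ.≤-reflexive (sym (once w))) in i , λ { refl → e }

∑-indicator : ∀ {n} (x : Fin n) → ∑[ w < n ] indicator (does (x Fin.≟ w)) ≡ 1
∑-indicator {suc n} Fin.zero    = cong suc (trans (sum-cong-≗ {n} (λ _ → refl)) (sum-replicate-zero n))
∑-indicator {suc n} (Fin.suc x) = ∑-indicator x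

length≡∑count : ∀ {A : Set} {n} (key : A → Fin n) xs →
                length xs ≡ ∑[ w < n ] count (hasKey key w) xs
length≡∑count {n = n} key []       = sym (trans (sum-cong-≗ {n} (λ _ → refl)) (sum-replicate-zero n))
length≡∑count {n = n} key (x ∷ xs) = begin
  suc (length xs)
    ≡⟨ cong₂ _+_ (sym (∑-indicator (key x))) (length≡∑count key xs) ⟩
  ∑[ w < n ] indicator (hasKey key w x) + ∑[ w < n ] count (hasKey key w) xs
    ≡⟨ sym (∑-distrib-+ {n} _ _) ⟩
  ∑[ w < n ] count (hasKey key w) (x ∷ xs) ∎
  where open ≡-Reasoning

∑-≤ : ∀ {n} c (f : Fin n → ℕ) → (∀ i → f i ≤ c) → ∑[ i < n ] f i ≤ n * c
∑-≤ {zero}  c f _     = z≤n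
∑-≤ {suc n} c f f≤c = ℕₚ.+-mono-≤ (f≤c Fin.zero) (∑-≤ c (f ∘ Fin.suc) (f≤c ∘ Fin.suc))

∉⇒∣p∣<n : ∀ {c} {x : Fin c} {F : Subset c} → x ∉ F → ∣ F ∣ < c
∉⇒∣p∣<n {c} {x} {F} x∉F =
  subst (∣ F ∣ <_) (Subsetₚ.∣⊤∣≡n c)
        (Subsetₚ.p⊂q⇒∣p∣<∣q∣ (Subsetₚ.⊆⊤ , x , Subsetₚ.∈⊤ , x∉F))

∉⇒∣p∣<∣p∪⁅x⁆∣ : ∀ {c} {x : Fin c} {F : Subset c} → x ∉ F → ∣ F ∣ < ∣ F ∪ ⁅ x ⁆ ∣
∉⇒∣p∣<∣p∪⁅x⁆∣ {x = x} x∉F =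
  Subsetₚ.p⊂q⇒∣p∣<∣q∣
    (Subsetₚ.p⊆p∪q ⁅ x ⁆ , x , Subsetₚ.x∈p∪q⁺ (inj₂ (Subsetₚ.x∈⁅x⁆ x)) , x∉F)

⊔<⊓ : ∀ {a b x y : ℤ} → a ℤ.< x → a ℤ.< y → b ℤ.< x → b ℤ.< y → a ⊔ b ℤ.< x ⊓ y
⊔<⊓ {a} {b} {x} {y} ax ay bx by with ℤₚ.⊔-sel a b | ℤₚ.⊓-sel x y
... | inj₁ e | inj₁ f rewrite e | f = ax
... | inj₁ e | inj₂ f rewrite e | f = ay
... | inj₂ e | inj₁ f rewrite e | f = bx
... | inj₂ e | inj₂ f rewrite e | f = by

⊔< : ∀ {a b x : ℤ} → a ℤ.< x → b ℤ.< x → a ⊔ b ℤ.< x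
⊔< {a} {b} ax bx with ℤₚ.⊔-sel a b
... | inj₁ e rewrite e = ax
... | inj₂ e rewrite e = bx

-≤-cancelʳ : ∀ {a b c} → a ℤ.- b ℤ.≤ c ℤ.- b → a ℤ.≤ c
-≤-cancelʳ {a} {b} {c} h =
  subst₂ ℤ._≤_ (//-rightDividesˡ b a) (//-rightDividesˡ b c) (ℤₚ.+-monoˡ-≤ b h)

relabel : ∀ {n c} → (Fin n → Label c → Label c) → Fin n × Label c → Fin n × Label c
relabel f (w , L) = w , f w L

mutual
  nodesN-mapNode : ∀ {n c} (f : Fin n → Label c → Label c) t →
                   nodesN (mapNode f t) ≡ map (relabel f) (nodesN t)
  nodesN-mapNode f (nd v l ts) = cong ((v , f v l) ∷_) (nodes-mapNodes f ts)

  nodes-mapNodes : ∀ {n c} (f : Fin n → Label c → Label c) ts →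
                   nodes (mapNodes f ts) ≡ map (relabel f) (nodes ts)
  nodes-mapNodes f []       = refl
  nodes-mapNodes f (t ∷ ts) =
    trans (cong₂ _++_ (nodesN-mapNode f t) (nodes-mapNodes f ts))
          (sym (map-++ (relabel f) (nodesN t) (nodes ts)))

module _ {n c : ℕ} where

  hasVertex : Fin n → Fin n × Label c → Bool
  hasVertex = hasKey proj₁

  isInode : Fin n × Label c → Bool
  isInode q = not (left (proj₂ q))

  occurrences : Fin n → Tree n c → ℕ
  occurrences w t = count (hasVertex w) (nodes t)

  Ioccurrences : Fin n → Tree n c → ℕ
  Ioccurrences w t = count (λ q → isInode q ∧ hasVertex w q) (nodes t)

  count-step : ∀ (p : Fin n × Label c → Bool) v L f′ f″ (t′ t″ : Tree n c) →
               count p (nodes (nd v L (mapNodes f′ t′) ∷ mapNodes f″ t″)) ≡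
               indicator (p (v , L)) + (count (p ∘ relabel f′) (nodes t′) + count (p ∘ relabel f″) (nodes t″))
  count-step p v L f′ f″ t′ t″ = begin
    count p ((v , L) ∷ nodes (mapNodes f′ t′) ++ nodes (mapNodes f″ t″))
      ≡⟨ count-++ p ((v , L) ∷ nodes (mapNodes f′ t′)) _ ⟩
    indicator (p (v , L)) + count p (nodes (mapNodes f′ t′)) + count p (nodes (mapNodes f″ t″))
      ≡⟨ ℕₚ.+-assoc (indicator (p (v , L))) _ _ ⟩
    indicator (p (v , L)) + (count p (nodes (mapNodes f′ t′)) + count p (nodes (mapNodes f″ t″)))
      ≡⟨ cong (indicator (p (v , L)) +_) (cong₂ _+_ (mapped f′ t′) (mapped f″ t″)) ⟩
    indicator (p (v , L)) + (count (p ∘ relabel f′) (nodes t′) + count (p ∘ relabel f″) (nodes t″)) ∎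
    where
    open ≡-Reasoning
    mapped : ∀ f t → count p (nodes (mapNodes f t)) ≡ count (p ∘ relabel f) (nodes t)
    mapped f t = trans (cong (count p) (nodes-mapNodes f t)) (count-map p (relabel f) (nodes t))

  stepTree : (Fin n → Fin c) → State n → Fin n → Tree n c → Tree n c → Tree n c
  stepTree col st v t′ t″ =
    nd v (lbl (col v) ∅ false false) (mapNodes (mod′ st v (col v)) t′) ∷ mapNodes (mod″ st v) t″

  occurrences-step : ∀ col st v w (t′ t″ : Tree n c) →
                     occurrences w (stepTree col st v t′ t″) ≡
                     indicator (does (v Fin.≟ w)) + (occurrences w t′ + occurrences w t″)
  occurrences-step col st v w =
    count-step (hasVertex w) v (lbl (col v) ∅ false false) (mod′ st v (col v)) (mod″ st v)

  Ioccurrences-step : ∀ col st v w (t′ t″ : Tree n c) →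
    Ioccurrences w (stepTree col st v t′ t″) ≡
    indicator (does (v Fin.≟ w)) + (Ioccurrences w t′ + (if not (both st v w) then Ioccurrences w t″ else 0))
  Ioccurrences-step col st v w t′ t″ =
    trans (count-step Iw v (lbl (col v) ∅ false false) (mod′ st v (col v)) (mod″ st v) t′ t″)
          (cong (λ m → indicator (does (v Fin.≟ w)) + (Ioccurrences w t′ + m))
                (trans (count-cong marked (nodes t″)) (count-if (not (both st v w)) Iw (nodes t″))))
    where
    Iw : Fin n × Label c → Bool
    Iw q = isInode q ∧ hasVertex w q

    not-∨-∧ : ∀ a b x → not (a ∨ b) ∧ x ≡ not b ∧ (not a ∧ x)
    not-∨-∧ true  true  x = refl
    not-∨-∧ true  false x = refl
    not-∨-∧ false true  x = refl
    not-∨-∧ false false x = refl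

    marked : ∀ q → Iw (relabel (mod″ st v) q) ≡ not (both st v w) ∧ Iw q
    marked (u , L) with u Fin.≟ w
    ... | yes refl = not-∨-∧ (left L) (both st v u) true
    ... | no _     =
      trans (∧-zeroʳ _) (sym (trans (cong (not (both st v w) ∧_) (∧-zeroʳ _)) (∧-zeroʳ _)))

Nonempty : ∀ {n} → State n → Set
Nonempty st = ∀ w → V st w ≡ true → start (I st w) ℤ.< end (I st w)

StartsFirst : ∀ {n} → State n → Fin n → Set
StartsFirst st w = ∀ u → V st u ≡ true → start (I st w) ℤ.≤ start (I st u)

module _ {n} (st : State n) (v : Fin n) (s : ℤ)
         (ne : Nonempty st) (fs : IsFirstSegment st s) (vs : I st v ∋seg s) where

  chosen-startsFirst : StartsFirst st v
  chosen-startsFirst u Vu =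
    ℤₚ.≤-trans (proj₁ vs) (proj₂ fs u (start (I st u)) Vu (ℤₚ.≤-refl , ne u Vu))

  startsFirst⇒end≤ : (∀ w → V st w ≡ true → I st w ∋seg s → len (I st w) ℤ.≤ len (I st v)) →
                     V st v ≡ true → ∀ w → V st w ≡ true → StartsFirst st w →
                     end (I st w) ℤ.≤ end (I st v)
  startsFirst⇒end≤ longest Vv w Vw w-first =
    -≤-cancelʳ (subst (λ k → end (I st w) ℤ.- k ℤ.≤ len (I st v)) sameStart (longest w Vw w∋s))
    where
    sameStart : start (I st w) ≡ start (I st v)
    sameStart = ℤₚ.≤-antisym (w-first v Vv) (chosen-startsFirst w Vw)
    w∋s : I st w ∋seg s
    w∋s = ℤₚ.≤-trans (w-first v Vv) (proj₁ vs) ,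
          ℤₚ.≤-<-trans (proj₂ fs w (start (I st w)) Vw (ℤₚ.≤-refl , ne w Vw)) (ne w Vw)

module Split {n : ℕ} (st : State n) (v : Fin n) (ne : Nonempty st)
             (Vv : V st v ≡ true) (v-first : StartsFirst st v) where

  private
    k ℓ : ℤ
    k = start (I st v)
    ℓ = end (I st v)

  v∉V′ : V′ st v v ≡ false
  v∉V′ rewrite Vv | dec-true (v Fin.≟ v) refl = refl

  v∉V″ : V″ st v v ≡ false
  v∉V″ rewrite Vv | dec-false (k ℤₚ.<? k) (ℤₚ.<-irrefl refl) | dec-false (ℓ ℤₚ.<? ℓ) (ℤₚ.<-irrefl refl)
    = refl

  V′⊆V : ∀ {w} → V′ st v w ≡ true → V st w ≡ true
  V′⊆V = ∧-trueˡ

  V″⊆V : ∀ {w} → V″ st v w ≡ true → V st w ≡ true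
  V″⊆V = ∧-trueˡ

  V′⇒≢ : ∀ {w} → V′ st v w ≡ true → w ≢ v
  V′⇒≢ e refl = not-¬ e v∉V′

  V′⇒meets : ∀ {w} → V′ st v w ≡ true → start (I st w) ℤ.< ℓ × k ℤ.< end (I st w)
  V′⇒meets {w} e =
    does-true (start (I st w) ℤₚ.<? ℓ) (∧-trueˡ meets) ,
    does-true (k ℤₚ.<? end (I st w)) (∧-trueʳ {does (start (I st w) ℤₚ.<? ℓ)} meets)
    where
    meets : intersectᵇ (I st w) (I st v) ≡ true
    meets = ∧-trueʳ {not (does (w Fin.≟ v))} (∧-trueʳ {V st w} e)

  V″⇒beyond : ∀ {w} → V″ st v w ≡ true → ℓ ℤ.< end (I st w)
  V″⇒beyond {w} e with ∨-true⁻ {does (start (I st w) ℤₚ.<? k)} (∧-trueʳ {V st w} e)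
  ... | inj₁ before =
    ⊥-elim (ℤₚ.≤⇒≯ (v-first w (V″⊆V e)) (does-true (start (I st w) ℤₚ.<? k) before))
  ... | inj₂ beyond = does-true (ℓ ℤₚ.<? end (I st w)) beyond

  V′-intro : ∀ {w} → V st w ≡ true → w ≢ v → start (I st w) ℤ.< ℓ → V′ st v w ≡ true
  V′-intro {w} Vw w≢v lt
    rewrite Vw | dec-false (w Fin.≟ v) w≢v | dec-true (start (I st w) ℤₚ.<? ℓ) lt
          | dec-true (k ℤₚ.<? end (I st w)) (ℤₚ.≤-<-trans (v-first w Vw) (ne w Vw)) = refl

  V″-intro : ∀ {w} → V st w ≡ true → ℓ ℤ.< end (I st w) → V″ st v w ≡ true
  V″-intro {w} Vw lt
    rewrite Vw | dec-true (ℓ ℤₚ.<? end (I st w)) lt | ∨-zeroʳ (does (start (I st w) ℤₚ.<? k))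
    = refl

  V″-within : ∀ {w} → end (I st w) ℤ.≤ ℓ → V″ st v w ≡ false
  V″-within {w} le with V″ st v w in e
  ... | true  = ⊥-elim (ℤₚ.≤⇒≯ le (V″⇒beyond e))
  ... | false = refl

  V′∨V″ : ∀ {w} → w ≢ v → V′ st v w ∨ V″ st v w ≡ V st w
  V′∨V″ {w} w≢v = byCases (V st w) refl (start (I st w) ℤₚ.<? ℓ)
    where
    byCases : ∀ b → V st w ≡ b → Dec (start (I st w) ℤ.< ℓ) → V′ st v w ∨ V″ st v w ≡ b
    byCases false Vw _ rewrite Vw = refl
    byCases true Vw (yes lt) rewrite V′-intro Vw w≢v lt = refl
    byCases true Vw (no ≮ℓ)
      rewrite V″-intro Vw (ℤₚ.≤-<-trans (ℤₚ.≮⇒≥ ≮ℓ) (ne w Vw)) = ∨-zeroʳ _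

  I″-beyond : ∀ {w} → V″ st v w ≡ true → I (sub″ st v) w ≡ (start (I st w) ⊔ ℓ , end (I st w))
  I″-beyond {w} e rewrite dec-true (ℓ ℤₚ.<? end (I st w)) (V″⇒beyond e) = refl

  nonempty′ : Nonempty (sub′ st v)
  nonempty′ w e = ⊔<⊓ (ne w (V′⊆V e)) (proj₁ (V′⇒meets e)) (proj₂ (V′⇒meets e)) (ne v Vv)

  nonempty″ : Nonempty (sub″ st v)
  nonempty″ w e rewrite I″-beyond e = ⊔< (ne w (V″⊆V e)) (V″⇒beyond e)

  startsFirst′ : ∀ {w} → StartsFirst st w → StartsFirst (sub′ st v) w
  startsFirst′ w-first u e = ℤₚ.⊔-monoˡ-≤ k (w-first u (V′⊆V e))

  -- J_w meets J_v, so its part beyond J_v starts at ℓ, the first segment of G″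
  startsFirst″ : ∀ {w} → V′ st v w ≡ true → V″ st v w ≡ true → StartsFirst (sub″ st v) w
  startsFirst″ {w} e′ e″ u e
    rewrite I″-beyond e″ | I″-beyond e | ℤₚ.i≤j⇒i⊔j≡j (ℤₚ.<⇒≤ (proj₁ (V′⇒meets e′)))
    = ℤₚ.i≤j⊔i _ ℓ

module _ {n c : ℕ} {col : Fin n → Fin c} where

  occurrences-absent : ∀ {st t} → BuildsTree col st t → ∀ w → V st w ≡ false → occurrences w t ≡ 0
  occurrences-absent (empty _) w _ = refl
  occurrences-absent {st} (step v _ {t′} {t″} _ Vv _ _ b′ b″) w Vw =
    trans (occurrences-step col st v w t′ t″)
          (cong₂ (λ b m → indicator b + m) (dec-false (v Fin.≟ w) v≢w)
                 (cong₂ _+_ (occurrences-absent b′ w (∧-falseˡ Vw))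
                            (occurrences-absent b″ w (∧-falseˡ Vw))))
    where
    v≢w : v ≢ w
    v≢w refl = not-¬ Vv Vw

  Ioccurrences≡indicator : ∀ {st t} → Nonempty st → BuildsTree col st t →
                           ∀ w → Ioccurrences w t ≡ indicator (V st w)
  Ioccurrences≡indicator ne (empty absent) w rewrite absent w = refl
  Ioccurrences≡indicator {st} ne (step v s {t′} {t″} fs Vv vs _ b′ b″) w = begin
    Ioccurrences w (stepTree col st v t′ t″)
      ≡⟨ Ioccurrences-step col st v w t′ t″ ⟩
    indicator (does (v Fin.≟ w)) + (Ioccurrences w t′ + (if not (both st v w) then Ioccurrences w t″ else 0))
      ≡⟨ cong₂ (λ a b → indicator (does (v Fin.≟ w)) + (a + (if not (both st v w) then b else 0)))
               (Ioccurrences≡indicator nonempty′ b′ w) (Ioccurrences≡indicator nonempty″ b″ w) ⟩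
    indicator (does (v Fin.≟ w)) +
      (indicator (V′ st v w) + (if not (both st v w) then indicator (V″ st v w) else 0))
      ≡⟨ split (v Fin.≟ w) ⟩
    indicator (V st w) ∎
    where
    open ≡-Reasoning
    open Split st v ne Vv (chosen-startsFirst st v s ne fs vs)

    inclusion–exclusion : ∀ a b →
                          indicator a + (if not (a ∧ b) then indicator b else 0) ≡ indicator (a ∨ b)
    inclusion–exclusion true  true  = refl
    inclusion–exclusion true  false = refl
    inclusion–exclusion false true  = refl
    inclusion–exclusion false false = refl

    split : (v≟w : Dec (v ≡ w)) →
      indicator (does v≟w) + (indicator (V′ st v w) + (if not (both st v w) then indicator (V″ st v w) else 0))
      ≡ indicator (V st w)
    split (yes refl) rewrite v∉V′ | v∉V″ | Vv = refl
    split (no v≢w)   =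
      trans (inclusion–exclusion (V′ st v w) (V″ st v w)) (cong indicator (V′∨V″ (v≢w ∘ sym)))

  occurrences-startsFirst : ∀ {st t} → Nonempty st → BuildsTree col st t →
                            ∀ w → V st w ≡ true → StartsFirst st w → occurrences w t ≡ 1
  occurrences-startsFirst ne (empty absent) w Vw _ = ⊥-elim (not-¬ Vw (absent w))
  occurrences-startsFirst {st} ne (step v s {t′} {t″} fs Vv vs longest b′ b″) w Vw w-first =
    trans (occurrences-step col st v w t′ t″) (split (v Fin.≟ w))
    where
    open Split st v ne Vv (chosen-startsFirst st v s ne fs vs)

    w<ℓ : start (I st w) ℤ.< end (I st v)
    w<ℓ = ℤₚ.≤-<-trans (w-first v Vv) (ne v Vv)

    split : (v≟w : Dec (v ≡ w)) → indicator (does v≟w) + (occurrences w t′ + occurrences w t″) ≡ 1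
    split (yes refl) rewrite occurrences-absent b′ v v∉V′ | occurrences-absent b″ v v∉V″ = refl
    split (no v≢w)
      rewrite occurrences-absent b″ w (V″-within (startsFirst⇒end≤ st v s ne fs vs longest Vv w Vw w-first))
            | occurrences-startsFirst nonempty′ b′ w (V′-intro Vw (v≢w ∘ sym) w<ℓ) (startsFirst′ w-first)
      = refl

module _ {n c : ℕ} {G : SimpleGraph n} (R : IntervalColoring G c) where

  WithinOriginal : State n → Set
  WithinOriginal st =
    ∀ w → V st w ≡ true → start (J R w) ℤ.≤ start (I st w) × end (I st w) ℤ.≤ end (J R w)

  AvoidsColours : State n → Subset c → Set
  AvoidsColours st F = ∀ w → V st w ≡ true → col R w ∉ F

  module SplitColours (st : State n) (v : Fin n) (ne : Nonempty st)
                      (Vv : V st v ≡ true) (v-first : StartsFirst st v) (within : WithinOriginal st) where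
    open Split st v ne Vv v-first

    within′ : WithinOriginal (sub′ st v)
    within′ w e = ℤₚ.≤-trans (proj₁ (within w (V′⊆V e))) (ℤₚ.i≤i⊔j _ _) ,
                  ℤₚ.≤-trans (ℤₚ.i⊓j≤i _ _) (proj₂ (within w (V′⊆V e)))

    within″ : WithinOriginal (sub″ st v)
    within″ w e rewrite I″-beyond e =
      ℤₚ.≤-trans (proj₁ (within w (V″⊆V e))) (ℤₚ.i≤i⊔j _ _) , proj₂ (within w (V″⊆V e))

    avoids′ : ∀ {F} → AvoidsColours st F → AvoidsColours (sub′ st v) (F ∪ ⁅ col R v ⁆)
    avoids′ {F} avoid w e x∈F∪v with Subsetₚ.x∈p∪q⁻ F ⁅ col R v ⁆ x∈F∪v
    ... | inj₁ x∈F = avoid w (V′⊆V e) x∈F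
    ... | inj₂ x≡v = proper R w v (V′⇒≢ e) meetsInOriginal (Subsetₚ.x∈⁅y⁆⇒x≡y _ x≡v)
      where
      Jw = within w (V′⊆V e)
      Jv = within v Vv
      meetsInOriginal : Intersect (J R w) (J R v)
      meetsInOriginal = ℤₚ.≤-<-trans (proj₁ Jw) (ℤₚ.<-≤-trans (proj₁ (V′⇒meets e)) (proj₂ Jv)) ,
                        ℤₚ.≤-<-trans (proj₁ Jv) (ℤₚ.<-≤-trans (proj₂ (V′⇒meets e)) (proj₂ Jw))

  occurrences+∣F∣≤c : ∀ {st t} (F : Subset c) → Nonempty st → WithinOriginal st → AvoidsColours st F →
                      BuildsTree (col R) st t → ∀ w → V st w ≡ true → occurrences w t + ∣ F ∣ ≤ c
  occurrences+∣F∣≤c F ne within avoid (empty absent) w Vw = ⊥-elim (not-¬ Vw (absent w))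
  occurrences+∣F∣≤c {st} F ne within avoid (step v s {t′} {t″} fs Vv vs longest b′ b″) w Vw =
    subst (λ m → m + ∣ F ∣ ≤ c)
          (sym (occurrences-step (col R) st v w t′ t″))
          (split (v Fin.≟ w))
    where
    open Split st v ne Vv (chosen-startsFirst st v s ne fs vs)
    open SplitColours st v ne Vv (chosen-startsFirst st v s ne fs vs) within
    open ℕₚ.≤-Reasoning

    IH′ : V′ st v w ≡ true → occurrences w t′ + ∣ F ∪ ⁅ col R v ⁆ ∣ ≤ c
    IH′ = occurrences+∣F∣≤c (F ∪ ⁅ col R v ⁆) nonempty′ within′ (avoids′ avoid) b′ w

    IH″ : V″ st v w ≡ true → occurrences w t″ + ∣ F ∣ ≤ c
    IH″ = occurrences+∣F∣≤c F nonempty″ within″ (λ u e → avoid u (V″⊆V e)) b″ w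

    atMostOnce″ : V′ st v w ≡ true → occurrences w t″ ≤ 1
    atMostOnce″ e′ with V″ st v w in e″
    ... | true  = ℕₚ.≤-reflexive (occurrences-startsFirst nonempty″ b″ w e″ (startsFirst″ e′ e″))
    ... | false = subst (_≤ 1) (sym (occurrences-absent b″ w e″)) z≤n

    split : (v≟w : Dec (v ≡ w)) →
            indicator (does v≟w) + (occurrences w t′ + occurrences w t″) + ∣ F ∣ ≤ c
    split (yes refl) rewrite occurrences-absent b′ v v∉V′ | occurrences-absent b″ v v∉V″
      = ∉⇒∣p∣<n (avoid v Vv)
    split (no _) with V′ st v w in e′
    ... | true = begin
      occurrences w t′ + occurrences w t″ + ∣ F ∣
        ≤⟨ ℕₚ.+-monoˡ-≤ ∣ F ∣ (ℕₚ.+-monoʳ-≤ (occurrences w t′) (atMostOnce″ e′)) ⟩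
      occurrences w t′ + 1 + ∣ F ∣
        ≡⟨ ℕₚ.+-assoc (occurrences w t′) 1 ∣ F ∣ ⟩
      occurrences w t′ + suc ∣ F ∣
        ≤⟨ ℕₚ.+-monoʳ-≤ (occurrences w t′) (∉⇒∣p∣<∣p∪⁅x⁆∣ (avoid v Vv)) ⟩
      occurrences w t′ + ∣ F ∪ ⁅ col R v ⁆ ∣
        ≤⟨ IH′ e′ ⟩
      c ∎
    ... | false rewrite occurrences-absent b′ w e′ with V″ st v w in e″
    ...   | true  = IH″ e″
    ...   | false rewrite occurrences-absent b″ w e″ = ℕₚ.<⇒≤ (∉⇒∣p∣<n (avoid w Vw))

lemma14 : (p n : ℕ) (G : SimpleGraph n) → HasPathWidth G p →
          (R : IntervalColoring G (suc p)) (t : Tree n (suc p)) → IsT G R t →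
          Isomorphic (Igraph G t) G × size t ≤ suc p * n + 1
lemma14 p n G _ R t built = isomorphism , sizeBound
  where
  nonempty₀ : Nonempty (initState G R)
  nonempty₀ w _ = nonempty R w

  onceInI : ∀ w → count (hasVertex w) (Inodes t) ≡ 1
  onceInI w =
    trans (count-filterᵇ isInode (hasVertex w) (nodes t)) (Ioccurrences≡indicator nonempty₀ built w)

  isomorphism : Isomorphic (Igraph G t) G
  isomorphism =
    proj₁ ∘ lookup (Inodes t) , key∘lookup-bijective proj₁ (Inodes t) onceInI , λ _ _ → mk⇔ id id

  atMost1+p : ∀ w → occurrences w t ≤ suc p
  atMost1+p w =
    subst (_≤ suc p) (trans (cong (occurrences w t +_) (Subsetₚ.∣⊥∣≡0 (suc p))) (ℕₚ.+-identityʳ _))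
          (occurrences+∣F∣≤c R ∅ nonempty₀ (λ _ _ → ℤₚ.≤-refl , ℤₚ.≤-refl) (λ _ _ → Subsetₚ.∉⊥)
                             built w refl)

  sizeBound : size t ≤ suc p * n + 1
  sizeBound = begin
    suc (length (nodes t))                ≡⟨ cong suc (length≡∑count proj₁ (nodes t)) ⟩
    suc (∑[ w < n ] occurrences w t)      ≤⟨ s≤s (∑-≤ (suc p) _ atMost1+p) ⟩
    suc (n * suc p)                       ≡⟨ cong suc (ℕₚ.*-comm n (suc p)) ⟩
    suc (suc p * n)                       ≡⟨ ℕₚ.+-comm 1 (suc p * n) ⟩
    suc p * n + 1                         ∎
    where open ℕₚ.≤-Reasoning
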